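{- Let $A$ be an abelian monoid with neutral element $0$, and let $X\subset A$ be a subset containing $0$. For each $k\geq 0$ put $$(HA)_X(k_+):=\Big\{ a=(a_1,\dots,a_k)\in A^k \ \Big|\ \sum_{j\in Z} a_j \in X \text{ for every subset } Z\subset\{1,\dots,k\}\Big\}.$$ Then $(HA)_X$ is a subfunctor of the functor $HA$, i.e. $(HA)_X(k_+)$ contains the base point $(0,\dots,0)$ of $HA(k_+)$, and for every base-point-preserving map $\phi:k_+\to m_+$ one has $\phi_*\big((HA)_X(k_+)\big)\subset (HA)_X(m_+)$. Moreover $(HA)_X(k_+)\subset X^k$.
   Context: For an integer $k\geq 0$, $k_+$ denotes the pointed set $\{*,1,\dots,k\}$ with base point $*$. The category $\Gamma^{\rm op}$ has objects $k_+$ and morphisms the base-point-preserving maps. An ${\mathbb S}$-module is a covariant functor from $\Gamma^{\rm op}$ to pointed sets. For an abelian monoid $A$, the ${\mathbb S}$-module $HA$ is given by $HA(k_+)=A^k$ (base point $(0,\dots,0)$), and for a base-point-preserving map $\phi:k_+\to m_+$, $\phi_*:A^k\to A^m$ is $\phi_*(a)(\ell)=\sum_{j\in\phi^{ -1}(\ell),\, j\neq *} a_j$ for $\ell\in\{1,\dots,m\}$. -}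

module Defs where

open import Level using (Level; _⊔_)
open import Algebra.Bundles using (CommutativeMonoid)
open import Data.Nat using (ℕ; zero; suc)
open import Data.Fin using (Fin; zero; suc)
open import Data.Fin.Properties using (_≟_)
open import Data.Maybe using (Maybe; just; nothing)
open import Data.Bool using (Bool; true; false; if_then_else_)
open import Relation.Nullary using (does)
open import Relation.Binary.PropositionalEquality using (_≡_)
open import Relation.Unary using (Pred; _∈_)
import Data.Maybe.Properties

-- the pointed set k₊ = {*,1,…,k}: nothing is the base point *, just j is j
_₊ : ℕ → Set
k ₊ = Maybe (Fin k)

record PointedMap (k m : ℕ) : Set where
  constructor pmap
  field
    fun    : k ₊ → m ₊
    pres-* : fun nothing ≡ nothing
open PointedMap public

module _ {c ℓ : Level} (A : CommutativeMonoid c ℓ) where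
  open CommutativeMonoid A renaming (Carrier to ∣A∣)

  HA : ℕ → Set c
  HA k = Fin k → ∣A∣

  HA-base : (k : ℕ) → HA k
  HA-base k _ = ε

  -- Σ_{j ∈ Z} a_j for a subset Z ⊆ {1,…,k} given by its characteristic function
  sumOver : {k : ℕ} → (Fin k → Bool) → HA k → ∣A∣
  sumOver {zero}  Z a = ε
  sumOver {suc k} Z a =
    (if Z zero then a zero else ε) ∙ sumOver (λ j → Z (suc j)) (λ j → a (suc j))

  -- φ_* : A^k → A^m,  φ_*(a)(ℓ) = Σ_{j ∈ φ⁻¹(ℓ), j ≠ *} a_j
  push : {k m : ℕ} → PointedMap k m → HA k → HA m
  push φ a l = sumOver (λ j → does (Data.Maybe.Properties.≡-dec _≟_ (fun φ (just j)) (just l))) a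

  HAX : {ℓX : Level} → Pred ∣A∣ ℓX → (k : ℕ) → Pred (HA k) ℓX
  HAX X k a = (Z : Fin k → Bool) → sumOver Z a ∈ X

-- Summing a over Z after pushing forward along φ is the same as summing a over the
-- preimage of Z under φ (a double sum over the fibres, reindexed). Hence every subset
-- sum of φ_*(a) is a subset sum of a, so the defining condition of (HA)_X is inherited;
-- the coordinates a_j are the singleton subset sums, and the base point has all subset
-- sums equal to 0.
module Submission where

open import Defs
open import Level using (Level)
open import Algebra.Bundles using (CommutativeMonoid)
import Algebra.Properties.CommutativeSemigroup as CommutativeSemigroupProperties
open import Data.Nat using (ℕ; zero; suc)
open import Data.Fin using (Fin; zero; suc)
open import Data.Fin.Properties using (_≟_)
open import Data.Maybe using (just; nothing)
open import Data.Maybe.Properties using (≡-dec)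
open import Data.Bool using (Bool; true; false; if_then_else_)
open import Data.Bool.Properties using (if-eta)
open import Data.Product using (_×_; _,_)
open import Function using (_∘_)
open import Relation.Nullary using (does)
open import Relation.Unary using (Pred; _∈_)

_≡ᵇ_ : {m : ℕ} → m ₊ → m ₊ → Bool
x ≡ᵇ y = does (≡-dec _≟_ x y)

_∋₊_ : {m : ℕ} → (Fin m → Bool) → m ₊ → Bool
W ∋₊ nothing = false
W ∋₊ just l  = W l

module _ {c ℓ : Level} (A : CommutativeMonoid c ℓ) where
  open CommutativeMonoid A renaming (Carrier to ∣A∣)
  open CommutativeSemigroupProperties commutativeSemigroup using (interchange)

  -- push A φ a is definitionally pushAlong (fun φ ∘ just) a.
  pushAlong : {k m : ℕ} → (Fin k → m ₊) → HA A k → HA A m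
  pushAlong f a l = sumOver A (λ j → f j ≡ᵇ just l) a

  -- single nothing v is the base point: mass sent to * disappears.
  single : {m : ℕ} → m ₊ → ∣A∣ → HA A m
  single x v l = if x ≡ᵇ just l then v else ε

  sumOver-ε : {k : ℕ} (Z : Fin k → Bool) → sumOver A Z (HA-base A k) ≈ ε
  sumOver-ε {zero}  Z = refl
  sumOver-ε {suc k} Z =
    trans (∙-cong (reflexive (if-eta (Z zero))) (sumOver-ε (Z ∘ suc))) (identityˡ ε)

  sumOver-∅ : {k : ℕ} (a : HA A k) → sumOver A (λ _ → false) a ≈ ε
  sumOver-∅ {zero}  a = refl
  sumOver-∅ {suc k} a = trans (identityˡ _) (sumOver-∅ (a ∘ suc))

  if-∙ : (b : Bool) (x y : ∣A∣) →
         (if b then x ∙ y else ε) ≈ (if b then x else ε) ∙ (if b then y else ε)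
  if-∙ true  x y = refl
  if-∙ false x y = sym (identityˡ ε)

  sumOver-∙ : {k : ℕ} (Z : Fin k → Bool) (a b : HA A k) →
              sumOver A Z (λ j → a j ∙ b j) ≈ sumOver A Z a ∙ sumOver A Z b
  sumOver-∙ {zero}  Z a b = sym (identityˡ ε)
  sumOver-∙ {suc k} Z a b =
    trans (∙-cong (if-∙ (Z zero) (a zero) (b zero)) (sumOver-∙ (Z ∘ suc) (a ∘ suc) (b ∘ suc)))
          (interchange _ _ _ _)

  sumOver-single : {m : ℕ} (W : Fin m → Bool) (x : m ₊) (v : ∣A∣) →
                   sumOver A W (single x v) ≈ (if W ∋₊ x then v else ε)
  sumOver-single W nothing v = sumOver-ε W
  sumOver-single {suc m} W (just zero) v =
    trans (∙-cong refl (sumOver-ε (W ∘ suc))) (identityʳ _)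
  sumOver-single {suc m} W (just (suc i)) v =
    trans (∙-cong (reflexive (if-eta (W zero))) (sumOver-single (W ∘ suc) (just i) v))
          (identityˡ _)

  sumOver-singleton : {k : ℕ} (a : HA A k) (j : Fin k) → sumOver A (λ i → does (j ≟ i)) a ≈ a j
  sumOver-singleton a zero    = trans (∙-cong refl (sumOver-∅ (a ∘ suc))) (identityʳ _)
  sumOver-singleton a (suc j) = trans (identityˡ _) (sumOver-singleton (a ∘ suc) j)

  -- pushAlong f a unfolds to single (f zero) (a zero) ∙ pushAlong (f ∘ suc) (a ∘ suc).
  sumOver-pushAlong : {k m : ℕ} (W : Fin m → Bool) (f : Fin k → m ₊) (a : HA A k) →
                      sumOver A W (pushAlong f a) ≈ sumOver A ((W ∋₊_) ∘ f) a
  sumOver-pushAlong {zero}  W f a = sumOver-ε W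
  sumOver-pushAlong {suc k} W f a =
    trans (sumOver-∙ W (single (f zero) (a zero)) (pushAlong (f ∘ suc) (a ∘ suc)))
          (∙-cong (sumOver-single W (f zero) (a zero)) (sumOver-pushAlong W (f ∘ suc) (a ∘ suc)))

lemma2p1 : {c ℓ ℓX : Level} (A : CommutativeMonoid c ℓ) (X : Pred (CommutativeMonoid.Carrier A) ℓX) →
    (∀ {x y} → CommutativeMonoid._≈_ A x y → x ∈ X → y ∈ X) →
    CommutativeMonoid.ε A ∈ X →
    ((k : ℕ) → HA-base A k ∈ HAX A X k)
    × ((k m : ℕ) (φ : PointedMap k m) (a : HA A k) → a ∈ HAX A X k → push A φ a ∈ HAX A X m)
    × ((k : ℕ) (a : HA A k) → a ∈ HAX A X k → (j : Fin k) → a j ∈ X)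
lemma2p1 A X X-resp-≈ ε∈X = base∈HAX , push-preserves-HAX , HAX⊆Xᵏ
  where
  open CommutativeMonoid A using (sym)

  base∈HAX : (k : ℕ) → HA-base A k ∈ HAX A X k
  base∈HAX k Z = X-resp-≈ (sym (sumOver-ε A Z)) ε∈X

  push-preserves-HAX : (k m : ℕ) (φ : PointedMap k m) (a : HA A k) →
                       a ∈ HAX A X k → push A φ a ∈ HAX A X m
  push-preserves-HAX k m φ a a∈HAX W =
    X-resp-≈ (sym (sumOver-pushAlong A W (fun φ ∘ just) a)) (a∈HAX _)

  HAX⊆Xᵏ : (k : ℕ) (a : HA A k) → a ∈ HAX A X k → (j : Fin k) → a j ∈ X
  HAX⊆Xᵏ k a a∈HAX j = X-resp-≈ (sumOver-singleton A a j) (a∈HAX _)
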